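{- Let $q$ be a prime power, $\mathrm{PG}(3,q)=\mathrm{AG}(3,q)\cup H_\infty$, and let $U\subset\mathrm{AG}(3,q)$ with $|U|=q^2$, $U$ not contained in a plane. Let $\ell_1,\ell_2$ be two distinct lines of $H_\infty$ not determined by $U$, and let $M=\ell_1\cap\ell_2$. Let $f$ and $g$ be affine lines contained in $U$ such that the ideal point of $f$ lies on $\ell_1$ and the ideal point of $g$ lies on $\ell_2$. Then $f$ and $g$ meet, or both $f$ and $g$ have ideal point $M$.
   Context: A line $\ell\subset H_\infty$ is determined by $U$ if some affine plane whose line at infinity is $\ell$ contains three non-collinear points of $U$. The ideal point of an affine line is its point at infinity. -}

module Defs where

open import Level using (0ℓ)
open import Data.Nat using (ℕ)
open import Data.Fin using (Fin)
open import Data.Product using (Σ; ∃; ∃-syntax; _×_; _,_)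
open import Data.List using (List; length)
open import Data.List.Membership.Propositional using (_∈_)
open import Data.List.Relation.Unary.All using (All)
open import Data.List.Relation.Unary.Unique.Propositional using (Unique)
open import Algebra.Structures using (IsCommutativeRing)
open import Function.Bundles using (_↔_)
open import Relation.Binary.PropositionalEquality using (_≡_; _≢_)
open import Relation.Nullary using (¬_)

-- Every finite field has prime-power order, and GF(q) exists and is
-- unique for each prime power q, so quantifying over all finite fields
-- is the same as quantifying over all prime powers q.
record FiniteField : Set₁ where
  field
    Carrier : Set
    _+_ _*_ : Carrier → Carrier → Carrier
    -_      : Carrier → Carrier
    0# 1#   : Carrier
    isCommutativeRing : IsCommutativeRing _≡_ _+_ _*_ -_ 0# 1#
    0≢1     : 0# ≢ 1#
    inverse : ∀ x → x ≢ 0# → ∃[ y ] (x * y ≡ 1#)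
    q       : ℕ
    enum    : Carrier ↔ Fin q

  infixl 6 _+_
  infixl 7 _*_

module Geometry (𝔽 : FiniteField) where
  open FiniteField 𝔽

  record Vec3 : Set where
    constructor ⟨_,_,_⟩
    field
      x₁ x₂ x₃ : Carrier

  Point : Set
  Point = Vec3

  zero3 : Vec3
  zero3 = ⟨ 0# , 0# , 0# ⟩

  _⊕_ : Vec3 → Vec3 → Vec3
  ⟨ a , b , c ⟩ ⊕ ⟨ a' , b' , c' ⟩ = ⟨ a + a' , b + b' , c + c' ⟩

  _⊖_ : Vec3 → Vec3 → Vec3
  ⟨ a , b , c ⟩ ⊖ ⟨ a' , b' , c' ⟩ = ⟨ a + - a' , b + - b' , c + - c' ⟩

  _·_ : Carrier → Vec3 → Vec3
  t · ⟨ a , b , c ⟩ = ⟨ t * a , t * b , t * c ⟩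

  dot : Vec3 → Vec3 → Carrier
  dot ⟨ a , b , c ⟩ ⟨ a' , b' , c' ⟩ = a * a' + b * b' + c * c'

  -- An affine line {p + t d : t ∈ F} with direction d ≠ 0.
  -- Its ideal point (point at infinity) is the projective point ⟨d⟩ of H∞.
  record AffLine : Set where
    constructor mkLine
    field
      base : Point
      dir  : Vec3
      dir≢0 : dir ≢ zero3

  OnLine : Point → AffLine → Set
  OnLine x (mkLine p d _) = ∃[ t ] (x ≡ p ⊕ (t · d))

  -- A line of H∞ (a plane at infinity line), given in dual coordinates by a
  -- nonzero normal vector n: it is the set of ideal points ⟨d⟩ with n·d = 0.
  record HLine : Set where
    constructor mkHLine
    field
      normal  : Vec3
      normal≢0 : normal ≢ zero3

  IdealOn : Vec3 → HLine → Set
  IdealOn d (mkHLine n _) = dot n d ≡ 0#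

  SameHLine : HLine → HLine → Set
  SameHLine (mkHLine n _) (mkHLine m _) = ∃[ t ] (m ≡ t · n)

  -- the affine plane {x : n·x = k}; its line at infinity is the H∞-line with normal n
  OnPlane : Point → Vec3 → Carrier → Set
  OnPlane x n k = dot n x ≡ k

  Collinear : Point → Point → Point → Set
  Collinear a b c = ∃[ L ] (OnLine a L × OnLine b L × OnLine c L)

  record PointSet : Set where
    constructor mkSet
    field
      elems  : List Point
      unique : Unique elems

  _∈U_ : Point → PointSet → Set
  x ∈U U = x ∈ PointSet.elems U

  size : PointSet → ℕ
  size U = length (PointSet.elems U)

  InPlane : PointSet → Set
  InPlane U = ∃[ n ] ∃[ k ] (n ≢ zero3 × All (λ x → OnPlane x n k) (PointSet.elems U))

  -- ℓ is determined by U: some affine plane whose line at infinity is ℓ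
  -- contains three non-collinear points of U.
  Determined : PointSet → HLine → Set
  Determined U ℓ = ∃[ k ] ∃[ a ] ∃[ b ] ∃[ c ]
    ( a ∈U U × b ∈U U × c ∈U U
    × OnPlane a (HLine.normal ℓ) k × OnPlane b (HLine.normal ℓ) k × OnPlane c (HLine.normal ℓ) k
    × ¬ Collinear a b c )

  LineIn : AffLine → PointSet → Set
  LineIn f U = ∀ x → OnLine x f → x ∈U U

  Meet : AffLine → AffLine → Set
  Meet f g = ∃[ x ] (OnLine x f × OnLine x g)

  -- the ideal point of f is M = ℓ₁ ∩ ℓ₂ (for distinct ℓ₁, ℓ₂ this intersection is one point)
  IdealPointIsMeet : AffLine → HLine → HLine → Set
  IdealPointIsMeet f ℓ₁ ℓ₂ = IdealOn (AffLine.dir f) ℓ₁ × IdealOn (AffLine.dir f) ℓ₂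

module Submission where

-- The lemma is a purely incidence-theoretic consequence of "ℓ is not
-- determined by U".
--
-- Key lemma.  Let ℓ be a line of H∞ not determined by U, f ⊆ U an affine
-- line with ideal point on ℓ, and g ⊆ U an affine line with ideal point off
-- ℓ.  Then f and g meet.  Indeed f lies in an affine plane π with line at
-- infinity ℓ, and g, being transversal to π, meets π in a point x ∈ U.  If x
-- were not on f, then x and two points of f would be three non-collinear
-- points of U in π, so ℓ would be determined by U.
--
-- The theorem follows by cases: if the ideal point of g is off ℓ₁ apply the
-- key lemma to (ℓ₁, f, g); if the ideal point of f is off ℓ₂ apply it to
-- (ℓ₂, g, f); otherwise both ideal points lie on ℓ₁ and ℓ₂, i.e. equal M.

open import Defs
open import Data.Product using (_×_)
open import Data.Sum using (_⊎_)
open import Relation.Binary.PropositionalEquality using (_≡_)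
open import Relation.Nullary using (¬_)

open import Level using (0ℓ)
open import Algebra.Bundles using (CommutativeRing)
import Algebra.Properties.AbelianGroup as AbelianGroupProperties
open import Data.Maybe using (nothing)
open import Data.Product using (_,_; ∃; ∃-syntax; proj₁; proj₂)
open import Data.Sum using (inj₁; inj₂)
open import Data.Fin.Properties using (inj⇒≟; any?)
open import Function.Bundles using (Inverse)
open import Function.Properties.Inverse using (↔⇒↣)
open import Relation.Binary.PropositionalEquality
  using (_≢_; refl; sym; trans; cong; subst; module ≡-Reasoning)
open import Relation.Nullary using (Dec; yes; no)
open import Relation.Nullary.Decidable using (map′; _×-dec_; decidable-stable)
open import Tactic.RingSolver.Core.AlmostCommutativeRing
  using (AlmostCommutativeRing; fromCommutativeRing)
open import Tactic.RingSolver using (solve-∀)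

module Proof (𝔽 : FiniteField) where
  open FiniteField 𝔽 using (Carrier; isCommutativeRing; inverse; enum)
  open Geometry 𝔽
  open ≡-Reasoning

  _≟_ : (x y : Carrier) → Dec (x ≡ y)
  _≟_ = inj⇒≟ (↔⇒↣ enum)

  vec≡ : ∀ {a b c a' b' c'} → a ≡ a' → b ≡ b' → c ≡ c' → ⟨ a , b , c ⟩ ≡ ⟨ a' , b' , c' ⟩
  vec≡ refl refl refl = refl

  _≟V_ : (u v : Vec3) → Dec (u ≡ v)
  ⟨ a , b , c ⟩ ≟V ⟨ a' , b' , c' ⟩ =
    map′ (λ { (e₁ , e₂ , e₃) → vec≡ e₁ e₂ e₃ })
         (λ e → cong Vec3.x₁ e , cong Vec3.x₂ e , cong Vec3.x₃ e)
         (a ≟ a' ×-dec b ≟ b' ×-dec c ≟ c')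

  ∃-scalar? : (P : Carrier → Set) → (∀ t → Dec (P t)) → Dec (∃ P)
  ∃-scalar? P P? =
    map′ (λ { (i , p) → from i , p })
         (λ { (t , p) → to t , subst P (sym (strictlyInverseʳ t)) p })
         (any? (λ i → P? (from i)))
    where open Inverse enum using (to; from; strictlyInverseʳ)

  onLine? : ∀ x f → Dec (OnLine x f)
  onLine? x (mkLine p d _) = ∃-scalar? _ (λ t → x ≟V (p ⊕ (t · d)))

  -- F as a commutative ring, and as an almost commutative
  -- ring for the ring solver; the operations are definitionally those of 𝔽,
  -- and we use the solver's copies so that it recognises them.  Without a
  -- computable zero test the solver cannot cancel terms, so it is only used
  -- for cancellation-free identities; the others come from the group laws.

  commutativeRing : CommutativeRing 0ℓ 0ℓ
  commutativeRing = record { isCommutativeRing = isCommutativeRing }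
  module R = CommutativeRing commutativeRing
  open AbelianGroupProperties R.+-abelianGroup using (xyx⁻¹≈y)

  ring : AlmostCommutativeRing 0ℓ 0ℓ
  ring = fromCommutativeRing commutativeRing (λ _ → nothing)
  open AlmostCommutativeRing ring using (_+_; _*_; -_; 0#; 1#)

  infixl 6 _-_
  _-_ : Carrier → Carrier → Carrier
  x - y = x + - y

  add-sub-cancel : ∀ x y → (x + y) - x ≡ y
  add-sub-cancel = xyx⁻¹≈y

  add-difference : ∀ x y → x + (y - x) ≡ y
  add-difference x y = trans (sym (R.+-assoc x y (- x))) (xyx⁻¹≈y x y)

  split-parameter : ∀ b s τ e → b + (s + τ) * e ≡ (b + s * e) + τ * e
  split-parameter = solve-∀ ring

  interchange : ∀ c u λ' e → (c * u) * (λ' * e) ≡ (c * e) * (λ' * u)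
  interchange = solve-∀ ring

  base-on-line : ∀ p d → p ≡ p ⊕ (0# · d)
  base-on-line ⟨ p₁ , p₂ , p₃ ⟩ ⟨ d₁ , d₂ , d₃ ⟩ = vec≡ (shift p₁ d₁) (shift p₂ d₂) (shift p₃ d₃)
    where
    shift : ∀ a e → a ≡ a + 0# * e
    shift a e = sym (trans (cong (a +_) (R.zeroˡ e)) (R.+-identityʳ a))

  zero-scaling : ∀ e → 0# · e ≡ zero3
  zero-scaling ⟨ e₁ , e₂ , e₃ ⟩ = vec≡ (R.zeroˡ e₁) (R.zeroˡ e₂) (R.zeroˡ e₃)

  dot-along-line : ∀ n p t d → dot n (p ⊕ (t · d)) ≡ dot n p + t * dot n d
  dot-along-line ⟨ n₁ , n₂ , n₃ ⟩ ⟨ a₁ , a₂ , a₃ ⟩ t ⟨ b₁ , b₂ , b₃ ⟩ = linear n₁ n₂ n₃ a₁ a₂ a₃ t b₁ b₂ b₃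
    where
    linear : ∀ n₁ n₂ n₃ a₁ a₂ a₃ t b₁ b₂ b₃ →
      n₁ * (a₁ + t * b₁) + n₂ * (a₂ + t * b₂) + n₃ * (a₃ + t * b₃)
        ≡ (n₁ * a₁ + n₂ * a₂ + n₃ * a₃) + t * (n₁ * b₁ + n₂ * b₂ + n₃ * b₃)
    linear = solve-∀ ring

  parallel-stays-in-plane : ∀ ℓ p t d → IdealOn d ℓ →
    dot (HLine.normal ℓ) (p ⊕ (t · d)) ≡ dot (HLine.normal ℓ) p
  parallel-stays-in-plane (mkHLine n _) p t d nd≡0 = begin
    dot n (p ⊕ (t · d))   ≡⟨ dot-along-line n p t d ⟩
    dot n p + t * dot n d ≡⟨ cong (λ z → dot n p + t * z) nd≡0 ⟩
    dot n p + t * 0#      ≡⟨ cong (dot n p +_) (R.zeroʳ t) ⟩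
    dot n p + 0#          ≡⟨ R.+-identityʳ (dot n p) ⟩
    dot n p               ∎

  -- A line whose ideal point is off ℓ meets every affine plane with line at
  -- infinity ℓ: solve a + t (n·d) = k for t.
  transversal-meets-plane : ∀ ℓ p d → ¬ IdealOn d ℓ → ∀ k →
    ∃[ t ] (dot (HLine.normal ℓ) (p ⊕ (t · d)) ≡ k)
  transversal-meets-plane (mkHLine n _) p d nd≢0 k = (k - a) * w , (begin
    dot n (p ⊕ (((k - a) * w) · d)) ≡⟨ dot-along-line n p ((k - a) * w) d ⟩
    a + ((k - a) * w) * dot n d      ≡⟨ cong (a +_) (R.*-assoc (k - a) w (dot n d)) ⟩
    a + (k - a) * (w * dot n d)      ≡⟨ cong (λ z → a + (k - a) * z) (trans (R.*-comm w (dot n d)) nd*w≡1) ⟩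
    a + (k - a) * 1#                 ≡⟨ cong (a +_) (R.*-identityʳ (k - a)) ⟩
    a + (k - a)                      ≡⟨ add-difference a k ⟩
    k                                ∎)
    where
    a : Carrier
    a = dot n p
    w : Carrier
    w = proj₁ (inverse (dot n d) nd≢0)
    nd*w≡1 : dot n d * w ≡ 1#
    nd*w≡1 = proj₂ (inverse (dot n d) nd≢0)

  direction-difference : ∀ a d b e s s' → a ≡ b ⊕ (s · e) → a ⊕ (1# · d) ≡ b ⊕ (s' · e) →
    d ≡ (s' - s) · e
  direction-difference ⟨ a₁ , a₂ , a₃ ⟩ ⟨ d₁ , d₂ , d₃ ⟩ ⟨ b₁ , b₂ , b₃ ⟩ ⟨ e₁ , e₂ , e₃ ⟩ s s' ha hb =
    vec≡ (scalar a₁ d₁ b₁ e₁ (cong Vec3.x₁ ha) (cong Vec3.x₁ hb))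
         (scalar a₂ d₂ b₂ e₂ (cong Vec3.x₂ ha) (cong Vec3.x₂ hb))
         (scalar a₃ d₃ b₃ e₃ (cong Vec3.x₃ ha) (cong Vec3.x₃ hb))
    where
    scalar : ∀ a d b e → a ≡ b + s * e → a + 1# * d ≡ b + s' * e → d ≡ (s' - s) * e
    scalar a d b e ha hb = begin
      d                                ≡⟨ sym (R.*-identityˡ d) ⟩
      1# * d                           ≡⟨ sym (add-sub-cancel a (1# * d)) ⟩
      (a + 1# * d) - a                 ≡⟨ cong (_- a) hb ⟩
      (b + s' * e) - a                 ≡⟨ cong (λ z → (b + z * e) - a) (sym (add-difference s s')) ⟩
      (b + (s + (s' - s)) * e) - a     ≡⟨ cong (_- a) (split-parameter b s (s' - s) e) ⟩
      ((b + s * e) + (s' - s) * e) - a ≡⟨ cong (λ z → (z + (s' - s) * e) - a) (sym ha) ⟩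
      (a + (s' - s) * e) - a           ≡⟨ add-sub-cancel a ((s' - s) * e) ⟩
      (s' - s) * e                     ∎

  rebase : ∀ a d b e s t λ' u → a ≡ b ⊕ (s · e) → d ≡ λ' · e → λ' * u ≡ 1# →
    b ⊕ (t · e) ≡ a ⊕ (((t - s) * u) · d)
  rebase ⟨ a₁ , a₂ , a₃ ⟩ ⟨ d₁ , d₂ , d₃ ⟩ ⟨ b₁ , b₂ , b₃ ⟩ ⟨ e₁ , e₂ , e₃ ⟩ s t λ' u ha hd λu≡1 =
    vec≡ (scalar b₁ e₁ a₁ d₁ (cong Vec3.x₁ ha) (cong Vec3.x₁ hd))
         (scalar b₂ e₂ a₂ d₂ (cong Vec3.x₂ ha) (cong Vec3.x₂ hd))
         (scalar b₃ e₃ a₃ d₃ (cong Vec3.x₃ ha) (cong Vec3.x₃ hd))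
    where
    scalar : ∀ b e a d → a ≡ b + s * e → d ≡ λ' * e → b + t * e ≡ a + ((t - s) * u) * d
    scalar b e _ _ refl refl = begin
      b + t * e                                ≡⟨ cong (λ z → b + z * e) (sym (add-difference s t)) ⟩
      b + (s + (t - s)) * e                    ≡⟨ split-parameter b s (t - s) e ⟩
      (b + s * e) + (t - s) * e                ≡⟨ cong ((b + s * e) +_) (sym (R.*-identityʳ ((t - s) * e))) ⟩
      (b + s * e) + ((t - s) * e) * 1#         ≡⟨ cong (λ z → (b + s * e) + ((t - s) * e) * z) (sym λu≡1) ⟩
      (b + s * e) + ((t - s) * e) * (λ' * u)   ≡⟨ cong ((b + s * e) +_) (sym (interchange (t - s) u λ' e)) ⟩
      (b + s * e) + ((t - s) * u) * (λ' * e)   ∎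

  collinear-on-line : ∀ a d (d≢0 : d ≢ zero3) x →
    Collinear a (a ⊕ (1# · d)) x → OnLine x (mkLine a d d≢0)
  collinear-on-line a d d≢0 x (mkLine b e _ , (s , ha) , (s' , hb) , (t , hx)) =
    (t - s) * u , (begin
      x                          ≡⟨ hx ⟩
      b ⊕ (t · e)                ≡⟨ rebase a d b e s t (s' - s) u ha d≡λe λu≡1 ⟩
      a ⊕ (((t - s) * u) · d)    ∎)
    where
    d≡λe : d ≡ (s' - s) · e
    d≡λe = direction-difference a d b e s s' ha hb
    λ≢0 : s' - s ≢ 0#
    λ≢0 λ≡0 = d≢0 (begin
      d             ≡⟨ d≡λe ⟩
      (s' - s) · e  ≡⟨ cong (_· e) λ≡0 ⟩
      0# · e        ≡⟨ zero-scaling e ⟩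
      zero3         ∎)
    u : Carrier
    u = proj₁ (inverse (s' - s) λ≢0)
    λu≡1 : (s' - s) * u ≡ 1#
    λu≡1 = proj₂ (inverse (s' - s) λ≢0)

  -- The meeting point is
  -- g ∩ π for the plane π ⊇ f with line at infinity ℓ; it lies on f, for
  -- otherwise it and two points of f would show that ℓ is determined.
  undetermined-forces-meeting : (U : PointSet) (ℓ : HLine) → ¬ Determined U ℓ →
    (f g : AffLine) → LineIn f U → LineIn g U →
    IdealOn (AffLine.dir f) ℓ → ¬ IdealOn (AffLine.dir g) ℓ → Meet f g
  undetermined-forces-meeting U ℓ undetermined f@(mkLine p d d≢0) (mkLine p' d' _) f⊆U g⊆U f∈ℓ g∉ℓ =
    x , decidable-stable (onLine? x f) x-not-off-f , (t , refl)
    where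
    n : Vec3
    n = HLine.normal ℓ
    t : Carrier
    t = proj₁ (transversal-meets-plane ℓ p' d' g∉ℓ (dot n p))
    x : Point
    x = p' ⊕ (t · d')
    x-not-off-f : ¬ ¬ OnLine x f
    x-not-off-f x∉f = undetermined
      ( dot n p , p , p ⊕ (1# · d) , x
      , f⊆U p (0# , base-on-line p d) , f⊆U _ (1# , refl) , g⊆U x (t , refl)
      , refl , parallel-stays-in-plane ℓ p 1# d f∈ℓ
      , proj₂ (transversal-meets-plane ℓ p' d' g∉ℓ (dot n p))
      , λ collinear → x∉f (collinear-on-line p d d≢0 x collinear))

  meet-sym : ∀ f g → Meet f g → Meet g f
  meet-sym _ _ (x , x∈f , x∈g) = x , x∈g , x∈f

  meet-or-common-ideal-point : (U : PointSet) (ℓ₁ ℓ₂ : HLine) → ¬ Determined U ℓ₁ → ¬ Determined U ℓ₂ →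
    (f g : AffLine) → LineIn f U → LineIn g U →
    IdealOn (AffLine.dir f) ℓ₁ → IdealOn (AffLine.dir g) ℓ₂ →
    Meet f g ⊎ (IdealPointIsMeet f ℓ₁ ℓ₂ × IdealPointIsMeet g ℓ₁ ℓ₂)
  meet-or-common-ideal-point U ℓ₁ ℓ₂ undet₁ undet₂ f g f⊆U g⊆U f∈ℓ₁ g∈ℓ₂ =
    by-cases (dot (HLine.normal ℓ₁) (AffLine.dir g) ≟ 0#)
             (dot (HLine.normal ℓ₂) (AffLine.dir f) ≟ 0#)
    where
    by-cases : Dec (IdealOn (AffLine.dir g) ℓ₁) → Dec (IdealOn (AffLine.dir f) ℓ₂) →
      Meet f g ⊎ (IdealPointIsMeet f ℓ₁ ℓ₂ × IdealPointIsMeet g ℓ₁ ℓ₂)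
    by-cases (no g∉ℓ₁) _ = inj₁ (undetermined-forces-meeting U ℓ₁ undet₁ f g f⊆U g⊆U f∈ℓ₁ g∉ℓ₁)
    by-cases (yes _) (no f∉ℓ₂) = inj₁ (meet-sym g f (undetermined-forces-meeting U ℓ₂ undet₂ g f g⊆U f⊆U g∈ℓ₂ f∉ℓ₂))
    by-cases (yes g∈ℓ₁) (yes f∈ℓ₂) = inj₂ ((f∈ℓ₁ , f∈ℓ₂) , (g∈ℓ₁ , g∈ℓ₂))

-- ℕ multiplication (in |U| = q·q) is imported only here, so that inside
-- Proof the symbol _*_ unambiguously denotes field multiplication.
open import Data.Nat using (_*_)

lemma1 : (𝔽 : FiniteField) → let open Geometry 𝔽 in
    (U : PointSet) → size U ≡ FiniteField.q 𝔽 * FiniteField.q 𝔽 → ¬ InPlane U →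
    (ℓ₁ ℓ₂ : HLine) → ¬ SameHLine ℓ₁ ℓ₂ → ¬ Determined U ℓ₁ → ¬ Determined U ℓ₂ →
    (f g : AffLine) → LineIn f U → LineIn g U →
    IdealOn (AffLine.dir f) ℓ₁ → IdealOn (AffLine.dir g) ℓ₂ →
    Meet f g ⊎ (IdealPointIsMeet f ℓ₁ ℓ₂ × IdealPointIsMeet g ℓ₁ ℓ₂)
lemma1 𝔽 U _ _ ℓ₁ ℓ₂ _ = Proof.meet-or-common-ideal-point 𝔽 U ℓ₁ ℓ₂
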